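{- Let $s,t$ be indeterminates and define the Lucas sequence $\{n\}\in\mathbb{Z}[s,t]$ by $\{0\}=0$, $\{1\}=1$ and $\{n\}=s\{n-1\}+t\{n-2\}$ for $n\ge 2$. Let $\{0\}!=1$ and $\{n\}!=\{1\}\{2\}\cdots\{n\}$, and for $0\le k\le n$ define the Lucanomial $\left\{ {n \atop k} \right\}=\frac{\{n\}!}{\{k\}!\,\{n-k\}!}$. Then for every integer $n\ge 0$, the Lucas-Catalan expression $$\frac{1}{\{n+1\}}\left\{ {2n \atop n} \right\}$$ is a polynomial in $s$ and $t$ all of whose coefficients are nonnegative integers (i.e., it is a polynomial with positive coefficients).
   Context: Here "a polynomial with positive coefficients" means an element of $\mathbb{Z}[s,t]$ every nonzero coefficient of which is a positive integer. The Lucanomials $\left\{ {n \atop k} \right\}$ are a priori rational functions in $s,t$. -}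

module Defs where

open import Data.Nat using (ℕ; zero; suc; _∸_; _≤_; _+_)
open import Data.Integer as ℤ using (ℤ; 0ℤ; 1ℤ)
open import Data.Product using (Σ; ∃; _×_)
open import Relation.Binary.PropositionalEquality using (_≡_)

-- Elements of ℤ[[s,t]] as coefficient functions: p i j = coefficient of s^i t^j.
-- ℤ[s,t] is the subring of finitely supported series (see IsPolynomial).
Ser : Set
Ser = ℕ → ℕ → ℤ

sumTo : ℕ → (ℕ → ℤ) → ℤ
sumTo zero    f = f zero
sumTo (suc n) f = sumTo n f ℤ.+ f (suc n)

zeroS : Ser
zeroS _ _ = 0ℤ

oneS : Ser
oneS zero zero = 1ℤ
oneS _    _    = 0ℤ

sVar : Ser
sVar (suc zero) zero = 1ℤ
sVar _          _    = 0ℤ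

tVar : Ser
tVar zero (suc zero) = 1ℤ
tVar _    _          = 0ℤ

_⊕_ : Ser → Ser → Ser
(p ⊕ q) i j = p i j ℤ.+ q i j

_⊗_ : Ser → Ser → Ser
(p ⊗ q) i j = sumTo i λ a → sumTo j λ b → p a b ℤ.* q (i ∸ a) (j ∸ b)

infixl 6 _⊕_
infixl 7 _⊗_
infix 4 _≈_

_≈_ : Ser → Ser → Set
p ≈ q = ∀ i j → p i j ≡ q i j

IsPolynomial : Ser → Set
IsPolynomial p = ∃ λ d → ∀ i j → d ≤ i + j → p i j ≡ 0ℤ

NonnegCoeffs : Ser → Set
NonnegCoeffs p = ∀ i j → ℤ.0ℤ ℤ.≤ p i j

lucas : ℕ → Ser
lucas zero = zeroS
lucas (suc zero) = oneS
lucas (suc (suc n)) = sVar ⊗ lucas (suc n) ⊕ tVar ⊗ lucas n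

lucasFact : ℕ → Ser
lucasFact zero    = oneS
lucasFact (suc n) = lucasFact n ⊗ lucas (suc n)

-- q is the quotient num / den in Frac(ℤ[s,t]) (den ≠ 0, ℤ[s,t] a domain):
-- q * den = num.
IsQuotient : Ser → Ser → Ser → Set
IsQuotient q num den = q ⊗ den ≈ num

LucasCatalanIs : ℕ → Ser → Set
LucasCatalanIs n P =
  IsQuotient P (lucasFact (n + n)) (lucas (suc n) ⊗ (lucasFact n ⊗ lucasFact ((n + n) ∸ n)))

-- The Lucas sequence satisfies the addition formula {a+b+1} = {a+1}{b+1} + t{a}{b}.  Splitting
-- {k+m+2} this way gives a Pascal-type recursion
--   {k+m+2 choose k+1} = {k+2}{k+m+1 choose k+1} + t{m}{k+m+1 choose k},
-- whose coefficients {k+2}, t{m} are positive polynomials, so every Lucanomial is one.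
-- Splitting {2n+2} = {n+2}{n+1} + t{n+1}{n} in the same way shows
--   (1/{n+2}) {2n+2 choose n+1} = {2n+1 choose n} + t{2n+1 choose n-1},
-- a positive polynomial as well.  The computations take place in ℤ[[s,t]], which is a
-- commutative semiring as power series in s over power series in t.

module Submission where

open import Algebra using (CommutativeSemiring)
open import Data.Integer as ℤ using (ℤ; 0ℤ; +_; +≤+)
import Data.Integer.Properties as ℤₚ
open import Data.Nat as ℕ using (ℕ; zero; suc; _∸_; _≤_; z≤n; s≤s; _≤?_)
import Data.Nat.Properties as ℕₚ
open import Data.Product using (Σ; _×_; _,_; proj₁; proj₂)
import Relation.Binary.PropositionalEquality as ≡
open import Relation.Nullary using (yes; no)

module PowerSeries {c ℓ} (R : CommutativeSemiring c ℓ) where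

  open CommutativeSemiring R hiding (zero)
  open import Relation.Binary.Reasoning.Setoid setoid
  open import Algebra.Solver.Ring.NaturalCoefficients.Default R using (solve; _:=_; _:+_)

  Series : Set c
  Series = ℕ → Carrier

  ∑ : ℕ → (ℕ → Carrier) → Carrier
  ∑ zero    f = f zero
  ∑ (suc n) f = ∑ n f + f (suc n)

  ∑-cong-≤ : ∀ n {f g} → (∀ a → a ≤ n → f a ≈ g a) → ∑ n f ≈ ∑ n g
  ∑-cong-≤ zero    f≈g = f≈g 0 z≤n
  ∑-cong-≤ (suc n) f≈g =
    +-cong (∑-cong-≤ n (λ a a≤n → f≈g a (ℕₚ.m≤n⇒m≤1+n a≤n))) (f≈g (suc n) ℕₚ.≤-refl)

  ∑-cong : ∀ n {f g} → (∀ a → f a ≈ g a) → ∑ n f ≈ ∑ n g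
  ∑-cong n f≈g = ∑-cong-≤ n (λ a _ → f≈g a)

  ∑-zero : ∀ n → ∑ n (λ _ → 0#) ≈ 0#
  ∑-zero zero    = refl
  ∑-zero (suc n) = trans (+-cong (∑-zero n) refl) (+-identityˡ 0#)

  ∑-+ : ∀ n f g → ∑ n (λ a → f a + g a) ≈ ∑ n f + ∑ n g
  ∑-+ zero    f g = refl
  ∑-+ (suc n) f g = begin
    ∑ n (λ a → f a + g a) + (f (suc n) + g (suc n))
      ≈⟨ +-cong (∑-+ n f g) refl ⟩
    (∑ n f + ∑ n g) + (f (suc n) + g (suc n))
      ≈⟨ solve 4 (λ a b c d → (a :+ b) :+ (c :+ d) := (a :+ c) :+ (b :+ d))
               refl (∑ n f) (∑ n g) (f (suc n)) (g (suc n)) ⟩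
    (∑ n f + f (suc n)) + (∑ n g + g (suc n)) ∎

  ∑-distribˡ : ∀ n x f → x * ∑ n f ≈ ∑ n (λ a → x * f a)
  ∑-distribˡ zero    x f = refl
  ∑-distribˡ (suc n) x f = trans (distribˡ x _ _) (+-cong (∑-distribˡ n x f) refl)

  ∑-distribʳ : ∀ n x f → ∑ n f * x ≈ ∑ n (λ a → f a * x)
  ∑-distribʳ zero    x f = refl
  ∑-distribʳ (suc n) x f = trans (distribʳ x _ _) (+-cong (∑-distribʳ n x f) refl)

  ∑-unconsˡ : ∀ n f → ∑ (suc n) f ≈ f 0 + ∑ n (λ a → f (suc a))
  ∑-unconsˡ zero    f = refl
  ∑-unconsˡ (suc n) f = trans (+-cong (∑-unconsˡ n f) refl) (+-assoc _ _ _)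

  ∑-reverse : ∀ n f → ∑ n f ≈ ∑ n (λ a → f (n ∸ a))
  ∑-reverse zero    f = refl
  ∑-reverse (suc n) f = sym (begin
    ∑ (suc n) (λ a → f (suc n ∸ a))     ≈⟨ ∑-unconsˡ n _ ⟩
    f (suc n) + ∑ n (λ a → f (n ∸ a))   ≈⟨ +-cong refl (sym (∑-reverse n f)) ⟩
    f (suc n) + ∑ n f                   ≈⟨ +-comm _ _ ⟩
    ∑ n f + f (suc n)                   ∎)

  ∑-triangle-swap : ∀ n (T : ℕ → ℕ → Carrier) →
                    ∑ n (λ a → ∑ a (λ b → T a b)) ≈ ∑ n (λ b → ∑ (n ∸ b) (λ c → T (b ℕ.+ c) b))
  ∑-triangle-swap zero    T = refl
  ∑-triangle-swap (suc n) T = begin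
    ∑ (suc n) (λ a → ∑ a (T a))
      ≈⟨ ∑-unconsˡ n _ ⟩
    T 0 0 + ∑ n (λ a → ∑ (suc a) (T (suc a)))
      ≈⟨ +-cong refl (∑-cong n (λ a → ∑-unconsˡ a (T (suc a)))) ⟩
    T 0 0 + ∑ n (λ a → T (suc a) 0 + ∑ a (λ b → T (suc a) (suc b)))
      ≈⟨ +-cong refl (∑-+ n _ _) ⟩
    T 0 0 + (∑ n (λ a → T (suc a) 0) + ∑ n (λ a → ∑ a (λ b → T (suc a) (suc b))))
      ≈⟨ +-cong refl (+-cong refl (∑-triangle-swap n (λ a b → T (suc a) (suc b)))) ⟩
    T 0 0 + (∑ n (λ a → T (suc a) 0) + ∑ n (λ b → ∑ (n ∸ b) (λ c → T (suc (b ℕ.+ c)) (suc b))))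
      ≈⟨ sym (+-assoc _ _ _) ⟩
    (T 0 0 + ∑ n (λ a → T (suc a) 0)) + ∑ n (λ b → ∑ (n ∸ b) (λ c → T (suc (b ℕ.+ c)) (suc b)))
      ≈⟨ +-cong (sym (∑-unconsˡ n (λ c → T c 0))) refl ⟩
    ∑ (suc n) (λ c → T c 0) + ∑ n (λ b → ∑ (n ∸ b) (λ c → T (suc (b ℕ.+ c)) (suc b)))
      ≈⟨ sym (∑-unconsˡ n _) ⟩
    ∑ (suc n) (λ b → ∑ (suc n ∸ b) (λ c → T (b ℕ.+ c) b)) ∎

  infix  4 _≋_
  infixl 6 _⊞_
  infixl 7 _⊛_

  _≋_ : Series → Series → Set ℓ
  f ≋ g = ∀ i → f i ≈ g i

  _⊞_ : Series → Series → Series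
  (f ⊞ g) i = f i + g i

  _⊛_ : Series → Series → Series
  (f ⊛ g) n = ∑ n (λ a → f a * g (n ∸ a))

  0ˢ : Series
  0ˢ _ = 0#

  1ˢ : Series
  1ˢ zero    = 1#
  1ˢ (suc _) = 0#

  ⊛-cong : ∀ {f f′ g g′} → f ≋ f′ → g ≋ g′ → f ⊛ g ≋ f′ ⊛ g′
  ⊛-cong f≋f′ g≋g′ n = ∑-cong n (λ a → *-cong (f≋f′ a) (g≋g′ (n ∸ a)))

  ⊛-comm : ∀ f g → f ⊛ g ≋ g ⊛ f
  ⊛-comm f g n = begin
    ∑ n (λ a → f a * g (n ∸ a))                 ≈⟨ ∑-reverse n _ ⟩
    ∑ n (λ a → f (n ∸ a) * g (n ∸ (n ∸ a)))     ≈⟨ ∑-cong-≤ n (λ a a≤n →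
                                                     trans (*-comm _ _)
                                                       (*-cong (reflexive (≡.cong g (ℕₚ.m∸[m∸n]≡n a≤n))) refl)) ⟩
    ∑ n (λ a → g a * f (n ∸ a))                 ∎

  ⊛-assoc : ∀ f g h → (f ⊛ g) ⊛ h ≋ f ⊛ (g ⊛ h)
  ⊛-assoc f g h n = begin
    ∑ n (λ a → ∑ a (λ b → f b * g (a ∸ b)) * h (n ∸ a))
      ≈⟨ ∑-cong n (λ a → ∑-distribʳ a _ _) ⟩
    ∑ n (λ a → ∑ a (λ b → (f b * g (a ∸ b)) * h (n ∸ a)))
      ≈⟨ ∑-triangle-swap n (λ a b → (f b * g (a ∸ b)) * h (n ∸ a)) ⟩
    ∑ n (λ b → ∑ (n ∸ b) (λ c → (f b * g (b ℕ.+ c ∸ b)) * h (n ∸ (b ℕ.+ c))))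
      ≈⟨ ∑-cong n (λ b → ∑-cong (n ∸ b) (λ c → trans (*-assoc _ _ _)
           (*-cong refl (*-cong (reflexive (≡.cong g (ℕₚ.m+n∸m≡n b c)))
                                (reflexive (≡.cong h (≡.sym (ℕₚ.∸-+-assoc n b c)))))))) ⟩
    ∑ n (λ b → ∑ (n ∸ b) (λ c → f b * (g c * h (n ∸ b ∸ c))))
      ≈⟨ ∑-cong n (λ b → sym (∑-distribˡ (n ∸ b) _ _)) ⟩
    ∑ n (λ b → f b * ∑ (n ∸ b) (λ c → g c * h (n ∸ b ∸ c))) ∎

  ⊛-distribˡ : ∀ f g h → f ⊛ (g ⊞ h) ≋ f ⊛ g ⊞ f ⊛ h
  ⊛-distribˡ f g h n = trans (∑-cong n (λ a → distribˡ _ _ _)) (∑-+ n _ _)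

  ⊛-identityˡ : ∀ f → 1ˢ ⊛ f ≋ f
  ⊛-identityˡ f zero    = *-identityˡ _
  ⊛-identityˡ f (suc n) = begin
    ∑ (suc n) (λ a → 1ˢ a * f (suc n ∸ a))    ≈⟨ ∑-unconsˡ n _ ⟩
    1# * f (suc n) + ∑ n (λ a → 0# * f (n ∸ a))
      ≈⟨ +-cong (*-identityˡ _) (trans (∑-cong n (λ a → zeroˡ _)) (∑-zero n)) ⟩
    f (suc n) + 0#                            ≈⟨ +-identityʳ _ ⟩
    f (suc n)                                 ∎

  ⊛-zeroˡ : ∀ f → 0ˢ ⊛ f ≋ 0ˢ
  ⊛-zeroˡ f n = trans (∑-cong n (λ a → zeroˡ _)) (∑-zero n)

  commutativeSemiring : CommutativeSemiring c ℓ
  commutativeSemiring = record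
    { Carrier = Series ; _≈_ = _≋_ ; _+_ = _⊞_ ; _*_ = _⊛_ ; 0# = 0ˢ ; 1# = 1ˢ
    ; isCommutativeSemiring = record
      { isSemiring = record
        { isSemiringWithoutAnnihilatingZero = record
          { +-isCommutativeMonoid = record
            { isMonoid = record
              { isSemigroup = record
                { isMagma = record
                  { isEquivalence = record
                    { refl = λ i → refl ; sym = λ f≋g i → sym (f≋g i)
                    ; trans = λ f≋g g≋h i → trans (f≋g i) (g≋h i) }
                  ; ∙-cong = λ f≋f′ g≋g′ i → +-cong (f≋f′ i) (g≋g′ i) }
                ; assoc = λ f g h i → +-assoc _ _ _ }
              ; identity = (λ f i → +-identityˡ _) , (λ f i → +-identityʳ _) }
            ; comm = λ f g i → +-comm _ _ }
          ; *-cong = ⊛-cong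
          ; *-assoc = ⊛-assoc
          ; *-identity = ⊛-identityˡ , (λ f n → trans (⊛-comm f 1ˢ n) (⊛-identityˡ f n))
          ; distrib = ⊛-distribˡ
                    , (λ f g h n → trans (⊛-comm (g ⊞ h) f n)
                                     (trans (⊛-distribˡ f g h n) (+-cong (⊛-comm f g n) (⊛-comm f h n)))) }
        ; zero = ⊛-zeroˡ , (λ f n → trans (⊛-comm f 0ˢ n) (⊛-zeroˡ f n)) }
      ; *-comm = ⊛-comm } }

open import Defs
open ≡ using (_≡_; refl; cong; cong₂)

module ℤ[[t]] = PowerSeries ℤₚ.+-*-commutativeSemiring
module ℤ[[t]][[s]] = PowerSeries ℤ[[t]].commutativeSemiring

open ℤ[[t]][[s]] using (_⊛_; 1ˢ)

sumTo-cong : ∀ n {f g : ℕ → ℤ} → (∀ a → f a ≡ g a) → sumTo n f ≡ sumTo n g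
sumTo-cong zero    f≡g = f≡g 0
sumTo-cong (suc n) f≡g = cong₂ ℤ._+_ (sumTo-cong n f≡g) (f≡g (suc n))

∑≡sumTo : ∀ n f → ℤ[[t]].∑ n f ≡ sumTo n f
∑≡sumTo zero    f = refl
∑≡sumTo (suc n) f = cong (ℤ._+ f (suc n)) (∑≡sumTo n f)

∑-coeff≡sumTo : ∀ n F j → ℤ[[t]][[s]].∑ n F j ≡ sumTo n (λ a → F a j)
∑-coeff≡sumTo zero    F j = refl
∑-coeff≡sumTo (suc n) F j = cong (ℤ._+ F (suc n) j) (∑-coeff≡sumTo n F j)

⊗≈⊛ : ∀ p q → p ⊗ q ≈ p ⊛ q
⊗≈⊛ p q i j = ≡.sym (≡.trans (∑-coeff≡sumTo i _ j) (sumTo-cong i (λ a → ∑≡sumTo j _)))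

oneS≈1ˢ : oneS ≈ 1ˢ
oneS≈1ˢ zero    zero    = refl
oneS≈1ˢ zero    (suc j) = refl
oneS≈1ˢ (suc i) j       = refl

-- _≈_ and _⊕_ on Ser are definitionally those of ℤ[[t]][[s]], so only the laws of _⊗_ and oneS
-- have to be transported along ⊗≈⊛ and oneS≈1ˢ.
Ser-commutativeSemiring : CommutativeSemiring _ _
Ser-commutativeSemiring = record
  { Carrier = Ser ; _≈_ = _≈_ ; _+_ = _⊕_ ; _*_ = _⊗_ ; 0# = zeroS ; 1# = oneS
  ; isCommutativeSemiring = record
    { isSemiring = record
      { isSemiringWithoutAnnihilatingZero = record
        { +-isCommutativeMonoid = +-isCommutativeMonoid
        ; *-cong = λ {p} {p′} {q} {q′} p≈p′ q≈q′ → via⊛ p q p′ q′ (⊛-cong p≈p′ q≈q′)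
        ; *-assoc = ⊗-assoc
        ; *-identity = ⊗-identityˡ , (λ p → ≈-trans (⊗-comm p oneS) (⊗-identityˡ p))
        ; distrib = ⊗-distribˡ
                  , (λ p q r → ≈-trans (⊗-comm (q ⊕ r) p)
                                 (≈-trans (⊗-distribˡ p q r) (+-cong (⊗-comm p q) (⊗-comm p r)))) }
      ; zero = ⊗-zeroˡ , (λ p → ≈-trans (⊗-comm p zeroS) (⊗-zeroˡ p)) }
    ; *-comm = ⊗-comm } }
  where
  open CommutativeSemiring ℤ[[t]][[s]].commutativeSemiring
    using (+-cong; +-isCommutativeMonoid)
    renaming (refl to ≈-refl; sym to ≈-sym; trans to ≈-trans;
              *-cong to ⊛-cong; *-assoc to ⊛-assoc; *-comm to ⊛-comm; distribˡ to ⊛-distribˡ;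
              *-identityˡ to ⊛-identityˡ; zeroˡ to ⊛-zeroˡ)

  via⊛ : ∀ p q p′ q′ → p ⊛ q ≈ p′ ⊛ q′ → p ⊗ q ≈ p′ ⊗ q′
  via⊛ p q p′ q′ eq = ≈-trans (⊗≈⊛ p q) (≈-trans eq (≈-sym (⊗≈⊛ p′ q′)))

  ⊗-comm : ∀ p q → p ⊗ q ≈ q ⊗ p
  ⊗-comm p q = via⊛ p q q p (⊛-comm p q)

  ⊗-assoc : ∀ p q r → (p ⊗ q) ⊗ r ≈ p ⊗ (q ⊗ r)
  ⊗-assoc p q r = via⊛ (p ⊗ q) r p (q ⊗ r)
    (≈-trans (⊛-cong {p ⊗ q} {p ⊛ q} {r} (⊗≈⊛ p q) ≈-refl)
      (≈-trans (⊛-assoc p q r) (⊛-cong {p} {p} {q ⊛ r} (≈-refl {p}) (≈-sym (⊗≈⊛ q r)))))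

  ⊗-distribˡ : ∀ p q r → p ⊗ (q ⊕ r) ≈ p ⊗ q ⊕ p ⊗ r
  ⊗-distribˡ p q r =
    ≈-trans (⊗≈⊛ p (q ⊕ r)) (≈-trans (⊛-distribˡ p q r) (+-cong (≈-sym (⊗≈⊛ p q)) (≈-sym (⊗≈⊛ p r))))

  ⊗-identityˡ : ∀ p → oneS ⊗ p ≈ p
  ⊗-identityˡ p =
    ≈-trans (⊗≈⊛ oneS p) (≈-trans (⊛-cong {oneS} {1ˢ} {p} oneS≈1ˢ (≈-refl {p})) (⊛-identityˡ p))

  ⊗-zeroˡ : ∀ p → zeroS ⊗ p ≈ zeroS
  ⊗-zeroˡ p = ≈-trans (⊗≈⊛ zeroS p) (⊛-zeroˡ p)

PositivePolynomial : Ser → Set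
PositivePolynomial p = IsPolynomial p × NonnegCoeffs p

sumTo-nonneg : ∀ n {f : ℕ → ℤ} → (∀ a → 0ℤ ℤ.≤ f a) → 0ℤ ℤ.≤ sumTo n f
sumTo-nonneg zero    f≥0 = f≥0 0
sumTo-nonneg (suc n) f≥0 = ℤₚ.+-mono-≤ (sumTo-nonneg n f≥0) (f≥0 (suc n))

sumTo-zero : ∀ n {f : ℕ → ℤ} → (∀ a → a ≤ n → f a ≡ 0ℤ) → sumTo n f ≡ 0ℤ
sumTo-zero zero    f≡0 = f≡0 0 z≤n
sumTo-zero (suc n) f≡0 =
  cong₂ ℤ._+_ (sumTo-zero n (λ a a≤n → f≡0 a (ℕₚ.m≤n⇒m≤1+n a≤n))) (f≡0 (suc n) ℕₚ.≤-refl)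

*-nonneg : ∀ {x y} → 0ℤ ℤ.≤ x → 0ℤ ℤ.≤ y → 0ℤ ℤ.≤ x ℤ.* y
*-nonneg {+ m} {+ n} _ _ = ≡.subst (0ℤ ℤ.≤_) (ℤₚ.pos-* m n) (+≤+ z≤n)

NonnegCoeffs-⊕ : ∀ {p q} → NonnegCoeffs p → NonnegCoeffs q → NonnegCoeffs (p ⊕ q)
NonnegCoeffs-⊕ p≥0 q≥0 i j = ℤₚ.+-mono-≤ (p≥0 i j) (q≥0 i j)

NonnegCoeffs-⊗ : ∀ {p q} → NonnegCoeffs p → NonnegCoeffs q → NonnegCoeffs (p ⊗ q)
NonnegCoeffs-⊗ p≥0 q≥0 i j =
  sumTo-nonneg i (λ a → sumTo-nonneg j (λ b → *-nonneg (p≥0 a b) (q≥0 (i ∸ a) (j ∸ b))))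

IsPolynomial-⊕ : ∀ {p q} → IsPolynomial p → IsPolynomial q → IsPolynomial (p ⊕ q)
IsPolynomial-⊕ (d₁ , p≡0) (d₂ , q≡0) =
  d₁ ℕ.+ d₂ , λ i j d≤i+j → cong₂ ℤ._+_ (p≡0 i j (ℕₚ.≤-trans (ℕₚ.m≤m+n d₁ d₂) d≤i+j))
                                        (q≡0 i j (ℕₚ.≤-trans (ℕₚ.m≤n+m d₂ d₁) d≤i+j))

cofactor-degree : ∀ {d₁ d₂ i j a b} → a ≤ i → b ≤ j → d₁ ℕ.+ d₂ ≤ i ℕ.+ j → a ℕ.+ b ≤ d₁ →
                  d₂ ≤ (i ∸ a) ℕ.+ (j ∸ b)
cofactor-degree {d₁} {d₂} {i} {j} {a} {b} a≤i b≤j d≤i+j a+b≤d₁ =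
  ℕₚ.+-cancelʳ-≤ (a ℕ.+ b) d₂ ((i ∸ a) ℕ.+ (j ∸ b)) (begin
    d₂ ℕ.+ (a ℕ.+ b)                   ≤⟨ ℕₚ.+-monoʳ-≤ d₂ a+b≤d₁ ⟩
    d₂ ℕ.+ d₁                          ≡⟨ ℕₚ.+-comm d₂ d₁ ⟩
    d₁ ℕ.+ d₂                          ≤⟨ d≤i+j ⟩
    i ℕ.+ j                            ≡⟨ cong₂ ℕ._+_ (≡.sym (ℕₚ.m∸n+n≡m a≤i)) (≡.sym (ℕₚ.m∸n+n≡m b≤j)) ⟩
    ((i ∸ a) ℕ.+ a) ℕ.+ ((j ∸ b) ℕ.+ b) ≡⟨ interchange (i ∸ a) a (j ∸ b) b ⟩
    ((i ∸ a) ℕ.+ (j ∸ b)) ℕ.+ (a ℕ.+ b) ∎)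
  where
  open ℕₚ.≤-Reasoning
  open import Data.Nat.Solver using (module +-*-Solver)
  open +-*-Solver using (solve; _:=_; _:+_)
  interchange : ∀ w x y z → (w ℕ.+ x) ℕ.+ (y ℕ.+ z) ≡ (w ℕ.+ y) ℕ.+ (x ℕ.+ z)
  interchange = solve 4 (λ w x y z → (w :+ x) :+ (y :+ z) := (w :+ y) :+ (x :+ z)) refl

IsPolynomial-⊗ : ∀ {p q} → IsPolynomial p → IsPolynomial q → IsPolynomial (p ⊗ q)
IsPolynomial-⊗ {p} {q} (d₁ , p≡0) (d₂ , q≡0) =
  d₁ ℕ.+ d₂ , λ i j d≤i+j →
    sumTo-zero i (λ a a≤i → sumTo-zero j (λ b b≤j → term≡0 a≤i b≤j d≤i+j))
  where
  term≡0 : ∀ {i j a b} → a ≤ i → b ≤ j → d₁ ℕ.+ d₂ ≤ i ℕ.+ j → p a b ℤ.* q (i ∸ a) (j ∸ b) ≡ 0ℤ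
  term≡0 {i} {j} {a} {b} a≤i b≤j d≤i+j with d₁ ≤? a ℕ.+ b
  ... | yes d₁≤a+b = cong (ℤ._* q (i ∸ a) (j ∸ b)) (p≡0 a b d₁≤a+b)
  ... | no  d₁≰a+b = ≡.trans (cong (p a b ℤ.*_) (q≡0 _ _ (cofactor-degree a≤i b≤j d≤i+j a+b≤d₁)))
                             (ℤₚ.*-zeroʳ (p a b))
    where a+b≤d₁ = ℕₚ.<⇒≤ (ℕₚ.≰⇒> d₁≰a+b)

positive-⊕ : ∀ {p q} → PositivePolynomial p → PositivePolynomial q → PositivePolynomial (p ⊕ q)
positive-⊕ (p-poly , p≥0) (q-poly , q≥0) = IsPolynomial-⊕ p-poly q-poly , NonnegCoeffs-⊕ p≥0 q≥0

positive-⊗ : ∀ {p q} → PositivePolynomial p → PositivePolynomial q → PositivePolynomial (p ⊗ q)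
positive-⊗ (p-poly , p≥0) (q-poly , q≥0) = IsPolynomial-⊗ p-poly q-poly , NonnegCoeffs-⊗ p≥0 q≥0

positive-zeroS : PositivePolynomial zeroS
positive-zeroS = (0 , λ _ _ _ → refl) , λ _ _ → +≤+ z≤n

positive-oneS : PositivePolynomial oneS
positive-oneS = (1 , vanish) , nonneg
  where
  vanish : ∀ i j → 1 ≤ i ℕ.+ j → oneS i j ≡ 0ℤ
  vanish zero    (suc j) _ = refl
  vanish (suc i) j       _ = refl
  nonneg : NonnegCoeffs oneS
  nonneg zero    zero    = +≤+ z≤n
  nonneg zero    (suc j) = +≤+ z≤n
  nonneg (suc i) j       = +≤+ z≤n

positive-sVar : PositivePolynomial sVar
positive-sVar = (2 , vanish) , nonneg
  where
  vanish : ∀ i j → 2 ≤ i ℕ.+ j → sVar i j ≡ 0ℤ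
  vanish zero          j       _           = refl
  vanish (suc zero)    zero    (s≤s ())
  vanish (suc zero)    (suc j) _           = refl
  vanish (suc (suc i)) j       _           = refl
  nonneg : NonnegCoeffs sVar
  nonneg zero          j       = +≤+ z≤n
  nonneg (suc zero)    zero    = +≤+ z≤n
  nonneg (suc zero)    (suc j) = +≤+ z≤n
  nonneg (suc (suc i)) j       = +≤+ z≤n

positive-tVar : PositivePolynomial tVar
positive-tVar = (2 , vanish) , nonneg
  where
  vanish : ∀ i j → 2 ≤ i ℕ.+ j → tVar i j ≡ 0ℤ
  vanish zero    zero          _           = refl
  vanish zero    (suc zero)    (s≤s ())
  vanish zero    (suc (suc j)) _           = refl
  vanish (suc i) j             _           = refl
  nonneg : NonnegCoeffs tVar
  nonneg zero    zero          = +≤+ z≤n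
  nonneg zero    (suc zero)    = +≤+ z≤n
  nonneg zero    (suc (suc j)) = +≤+ z≤n
  nonneg (suc i) j             = +≤+ z≤n

positive-lucas : ∀ n → PositivePolynomial (lucas n)
positive-lucas zero          = positive-zeroS
positive-lucas (suc zero)    = positive-oneS
positive-lucas (suc (suc n)) =
  positive-⊕ (positive-⊗ positive-sVar (positive-lucas (suc n)))
             (positive-⊗ positive-tVar (positive-lucas n))

open CommutativeSemiring Ser-commutativeSemiring
  using (setoid; +-cong; *-congˡ) renaming (refl to ≈-refl)
open import Relation.Binary.Reasoning.Setoid setoid
open import Algebra.Solver.Ring.NaturalCoefficients.Default Ser-commutativeSemiring
  using (solve; _:=_; _:+_; _:*_; con)

lucas-+ : ∀ a b → lucas (suc (a ℕ.+ b)) ≈ lucas (suc a) ⊗ lucas (suc b) ⊕ tVar ⊗ (lucas a ⊗ lucas b)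
lucas-+ zero b =
  solve 3 (λ x t y → x := con 1 :* x :+ t :* (con 0 :* y)) ≈-refl (lucas (suc b)) tVar (lucas b)
lucas-+ (suc zero) b =
  solve 4 (λ s t x y → s :* x :+ t :* y := (s :* con 1 :+ t :* con 0) :* x :+ t :* (con 1 :* y))
        ≈-refl sVar tVar (lucas (suc b)) (lucas b)
lucas-+ (suc (suc a)) b = begin
  sVar ⊗ lucas (suc (suc a ℕ.+ b)) ⊕ tVar ⊗ lucas (suc (a ℕ.+ b))
    ≈⟨ +-cong (*-congˡ {sVar} (lucas-+ (suc a) b)) (*-congˡ {tVar} (lucas-+ a b)) ⟩
  sVar ⊗ (L₂ ⊗ M₁ ⊕ tVar ⊗ (L₁ ⊗ M₀)) ⊕ tVar ⊗ (L₁ ⊗ M₁ ⊕ tVar ⊗ (L₀ ⊗ M₀))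
    ≈⟨ solve 7 (λ s t L₂ L₁ L₀ M₁ M₀ →
                  s :* (L₂ :* M₁ :+ t :* (L₁ :* M₀)) :+ t :* (L₁ :* M₁ :+ t :* (L₀ :* M₀))
                  := (s :* L₂ :+ t :* L₁) :* M₁ :+ t :* ((s :* L₁ :+ t :* L₀) :* M₀))
               ≈-refl sVar tVar L₂ L₁ L₀ M₁ M₀ ⟩
  lucas (suc (suc (suc a))) ⊗ M₁ ⊕ tVar ⊗ (L₂ ⊗ M₀) ∎
  where
  L₂ = lucas (suc (suc a)) ; L₁ = lucas (suc a) ; L₀ = lucas a
  M₁ = lucas (suc b) ; M₀ = lucas b

-- lucanomial k m is {k+m choose k}.
lucanomial : ℕ → ℕ → Ser
lucanomial zero    m       = oneS
lucanomial (suc k) zero    = oneS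
lucanomial (suc k) (suc m) =
  lucas (suc (suc k)) ⊗ lucanomial (suc k) m ⊕ tVar ⊗ lucas m ⊗ lucanomial k (suc m)

lucanomial-⊗-factorials : ∀ k m → lucanomial k m ⊗ (lucasFact k ⊗ lucasFact m) ≈ lucasFact (k ℕ.+ m)
lucanomial-⊗-factorials zero m = solve 1 (λ F → con 1 :* (con 1 :* F) := F) ≈-refl (lucasFact m)
lucanomial-⊗-factorials (suc k) zero = begin
  oneS ⊗ (lucasFact (suc k) ⊗ oneS) ≈⟨ solve 1 (λ F → con 1 :* (F :* con 1) := F) ≈-refl (lucasFact (suc k)) ⟩
  lucasFact (suc k)                 ≡⟨ cong lucasFact (≡.sym (ℕₚ.+-identityʳ (suc k))) ⟩
  lucasFact (suc k ℕ.+ zero)        ∎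
lucanomial-⊗-factorials (suc k) (suc m) = begin
  (K₂ ⊗ B₁ ⊕ tVar ⊗ M₀ ⊗ B₂) ⊗ ((Fk ⊗ K₁) ⊗ (Fm ⊗ M₁))
    ≈⟨ solve 9 (λ K₂ B₁ t M₀ B₂ Fk K₁ Fm M₁ →
                  (K₂ :* B₁ :+ t :* M₀ :* B₂) :* ((Fk :* K₁) :* (Fm :* M₁))
                  := K₂ :* M₁ :* (B₁ :* ((Fk :* K₁) :* Fm)) :+ t :* K₁ :* M₀ :* (B₂ :* (Fk :* (Fm :* M₁))))
               ≈-refl K₂ B₁ tVar M₀ B₂ Fk K₁ Fm M₁ ⟩
  K₂ ⊗ M₁ ⊗ (B₁ ⊗ ((Fk ⊗ K₁) ⊗ Fm)) ⊕ tVar ⊗ K₁ ⊗ M₀ ⊗ (B₂ ⊗ (Fk ⊗ (Fm ⊗ M₁)))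
    ≈⟨ +-cong (*-congˡ {K₂ ⊗ M₁} (λ i j → ≡.trans (lucanomial-⊗-factorials (suc k) m i j)
                                                  (cong (λ n → lucasFact n i j) (≡.sym (ℕₚ.+-suc k m)))))
              (*-congˡ {tVar ⊗ K₁ ⊗ M₀} (lucanomial-⊗-factorials k (suc m))) ⟩
  K₂ ⊗ M₁ ⊗ X ⊕ tVar ⊗ K₁ ⊗ M₀ ⊗ X
    ≈⟨ solve 6 (λ K₂ M₁ t K₁ M₀ X → K₂ :* M₁ :* X :+ t :* K₁ :* M₀ :* X := X :* (K₂ :* M₁ :+ t :* (K₁ :* M₀)))
               ≈-refl K₂ M₁ tVar K₁ M₀ X ⟩
  X ⊗ (K₂ ⊗ M₁ ⊕ tVar ⊗ (K₁ ⊗ M₀))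
    ≈⟨ *-congˡ {X} (λ i j → ≡.sym (lucas-+ (suc k) m i j)) ⟩
  X ⊗ lucas (suc (suc k ℕ.+ m))
    ≡⟨ cong (λ n → X ⊗ lucas (suc n)) (≡.sym (ℕₚ.+-suc k m)) ⟩
  X ⊗ lucas (suc (k ℕ.+ suc m)) ∎
  where
  K₂ = lucas (suc (suc k)) ; K₁ = lucas (suc k) ; M₁ = lucas (suc m) ; M₀ = lucas m
  B₁ = lucanomial (suc k) m ; B₂ = lucanomial k (suc m) ; Fk = lucasFact k ; Fm = lucasFact m
  X = lucasFact (k ℕ.+ suc m)

positive-lucanomial : ∀ k m → PositivePolynomial (lucanomial k m)
positive-lucanomial zero    m       = positive-oneS
positive-lucanomial (suc k) zero    = positive-oneS
positive-lucanomial (suc k) (suc m) =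
  positive-⊕ (positive-⊗ (positive-lucas (suc (suc k))) (positive-lucanomial (suc k) m))
             (positive-⊗ (positive-⊗ positive-tVar (positive-lucas m)) (positive-lucanomial k (suc m)))

-- {2k+1 choose k-1}, which is 0 for k = 0.
subcentralLucanomial : ℕ → Ser
subcentralLucanomial zero    = zeroS
subcentralLucanomial (suc j) = lucanomial j (suc (suc (suc j)))

subcentralLucanomial-⊗-factorials : ∀ k →
  subcentralLucanomial k ⊗ (lucas (suc (suc k)) ⊗ (lucasFact (suc k) ⊗ lucasFact (suc k)))
    ≈ lucas (suc k) ⊗ lucas k ⊗ lucasFact (k ℕ.+ suc k)
subcentralLucanomial-⊗-factorials zero =
  solve 3 (λ P L₁ F₁ → con 0 :* P := L₁ :* con 0 :* F₁) ≈-refl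
        (lucas 2 ⊗ (lucasFact 1 ⊗ lucasFact 1)) (lucas 1) (lucasFact 1)
subcentralLucanomial-⊗-factorials (suc j) = begin
  B ⊗ (L₃ ⊗ ((Fj ⊗ L₁ ⊗ L₂) ⊗ (Fj ⊗ L₁ ⊗ L₂)))
    ≈⟨ solve 5 (λ B L₁ L₂ L₃ Fj → B :* (L₃ :* ((Fj :* L₁ :* L₂) :* (Fj :* L₁ :* L₂)))
                                   := L₂ :* L₁ :* (B :* (Fj :* (((Fj :* L₁) :* L₂) :* L₃))))
               ≈-refl B L₁ L₂ L₃ Fj ⟩
  L₂ ⊗ L₁ ⊗ (B ⊗ (Fj ⊗ lucasFact (suc (suc (suc j)))))
    ≈⟨ *-congˡ {L₂ ⊗ L₁} (lucanomial-⊗-factorials j (suc (suc (suc j)))) ⟩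
  L₂ ⊗ L₁ ⊗ lucasFact (j ℕ.+ suc (suc (suc j)))
    ≡⟨ cong (λ n → L₂ ⊗ L₁ ⊗ lucasFact n) (ℕₚ.+-suc j (suc (suc j))) ⟩
  L₂ ⊗ L₁ ⊗ lucasFact (suc j ℕ.+ suc (suc j)) ∎
  where
  B = subcentralLucanomial (suc j) ; Fj = lucasFact j
  L₁ = lucas (suc j) ; L₂ = lucas (suc (suc j)) ; L₃ = lucas (suc (suc (suc j)))

lucasCatalan : ℕ → Ser
lucasCatalan zero    = oneS
lucasCatalan (suc k) = lucanomial k (suc k) ⊕ tVar ⊗ subcentralLucanomial k

lucasCatalan-⊗-factorials : ∀ n →
  lucasCatalan n ⊗ (lucas (suc n) ⊗ (lucasFact n ⊗ lucasFact n)) ≈ lucasFact (n ℕ.+ n)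
lucasCatalan-⊗-factorials zero = solve 0 (con 1 :* (con 1 :* (con 1 :* con 1)) := con 1) ≈-refl
lucasCatalan-⊗-factorials (suc k) = begin
  (B ⊕ tVar ⊗ Q) ⊗ (K₂ ⊗ ((Fk ⊗ K₁) ⊗ (Fk ⊗ K₁)))
    ≈⟨ solve 6 (λ B t Q K₂ Fk K₁ → (B :+ t :* Q) :* (K₂ :* ((Fk :* K₁) :* (Fk :* K₁)))
                                   := K₂ :* K₁ :* (B :* (Fk :* (Fk :* K₁)))
                                      :+ t :* (Q :* (K₂ :* ((Fk :* K₁) :* (Fk :* K₁)))))
               ≈-refl B tVar Q K₂ Fk K₁ ⟩
  K₂ ⊗ K₁ ⊗ (B ⊗ (Fk ⊗ (Fk ⊗ K₁))) ⊕ tVar ⊗ (Q ⊗ (K₂ ⊗ ((Fk ⊗ K₁) ⊗ (Fk ⊗ K₁))))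
    ≈⟨ +-cong (*-congˡ {K₂ ⊗ K₁} (lucanomial-⊗-factorials k (suc k)))
              (*-congˡ {tVar} (subcentralLucanomial-⊗-factorials k)) ⟩
  K₂ ⊗ K₁ ⊗ Y ⊕ tVar ⊗ (K₁ ⊗ K₀ ⊗ Y)
    ≈⟨ solve 5 (λ K₂ K₁ K₀ t Y → K₂ :* K₁ :* Y :+ t :* (K₁ :* K₀ :* Y) := Y :* (K₂ :* K₁ :+ t :* (K₁ :* K₀)))
               ≈-refl K₂ K₁ K₀ tVar Y ⟩
  Y ⊗ (K₂ ⊗ K₁ ⊕ tVar ⊗ (K₁ ⊗ K₀))
    ≈⟨ *-congˡ {Y} (λ i j → ≡.sym (lucas-+ (suc k) k i j)) ⟩
  Y ⊗ lucas (suc (suc k ℕ.+ k))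
    ≡⟨ cong (λ n → Y ⊗ lucas (suc n)) (≡.sym (ℕₚ.+-suc k k)) ⟩
  Y ⊗ lucas (suc (k ℕ.+ suc k)) ∎
  where
  B = lucanomial k (suc k) ; Q = subcentralLucanomial k ; Fk = lucasFact k
  K₂ = lucas (suc (suc k)) ; K₁ = lucas (suc k) ; K₀ = lucas k
  Y = lucasFact (k ℕ.+ suc k)

positive-subcentralLucanomial : ∀ k → PositivePolynomial (subcentralLucanomial k)
positive-subcentralLucanomial zero    = positive-zeroS
positive-subcentralLucanomial (suc j) = positive-lucanomial j (suc (suc (suc j)))

positive-lucasCatalan : ∀ n → PositivePolynomial (lucasCatalan n)
positive-lucasCatalan zero    = positive-oneS
positive-lucasCatalan (suc k) =
  positive-⊕ (positive-lucanomial k (suc k)) (positive-⊗ positive-tVar (positive-subcentralLucanomial k))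

mainTheorem1 : (n : ℕ) → Σ Ser (λ P → IsPolynomial P × NonnegCoeffs P × LucasCatalanIs n P)
mainTheorem1 n =
  lucasCatalan n , proj₁ (positive-lucasCatalan n) , proj₂ (positive-lucasCatalan n) , quotient
  where
  quotient : LucasCatalanIs n (lucasCatalan n)
  quotient = begin
    lucasCatalan n ⊗ (lucas (suc n) ⊗ (lucasFact n ⊗ lucasFact ((n ℕ.+ n) ∸ n)))
      ≡⟨ cong (λ m → lucasCatalan n ⊗ (lucas (suc n) ⊗ (lucasFact n ⊗ lucasFact m))) (ℕₚ.m+n∸n≡m n n) ⟩
    lucasCatalan n ⊗ (lucas (suc n) ⊗ (lucasFact n ⊗ lucasFact n))
      ≈⟨ lucasCatalan-⊗-factorials n ⟩
    lucasFact (n ℕ.+ n) ∎
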